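{- Fix $k\ge 3$. If $N,n,r,s$ are positive integers with $n>k$, $1\le s\le r/2$ and $R_k(n;r,s)>N>0$, then $R_{k+1}(2n-1;r,s)>2^N$.
   Context: For positive integers $n,k,r,s$ with $n>k$ and $r>s$, an $(r,s)$-coloring of the complete $k$-uniform hypergraph $K_N^{(k)}$ is a map $\chi:E(K_N^{(k)})\to\binom{[r]}{s}$. A monochromatic $n$-clique is a set of $n$ vertices such that all $\binom{n}{k}$ edges within it contain a common color. $R_k(n;r,s)$ is the minimum $N$ such that every $(r,s)$-coloring of $K_N^{(k)}$ contains a monochromatic $n$-clique. -}

module Defs where

open import Data.Nat using (ℕ; _≤_)
open import Data.Fin using (Fin)
open import Data.Fin.Subset using (Subset; ∣_∣; _∈_; _⊆_)
open import Data.Product using (Σ; ∃; _×_)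
open import Relation.Binary.PropositionalEquality using (_≡_)
open import Relation.Nullary using (¬_)

record Coloring (k N r s : ℕ) : Set where
  field
    colour      : (e : Subset N) → ∣ e ∣ ≡ k → Subset r
    colour-size : (e : Subset N) (h : ∣ e ∣ ≡ k) → ∣ colour e h ∣ ≡ s
open Coloring public

MonoClique : ∀ {k N r s} → Coloring k N r s → ℕ → Set
MonoClique {k} {N} {r} χ n =
  Σ (Subset N) λ S → (∣ S ∣ ≡ n) × (∃ λ (c : Fin r) →
     (e : Subset N) (h : ∣ e ∣ ≡ k) → e ⊆ S → c ∈ colour χ e h)

Arrows : (k n r s N : ℕ) → Set
Arrows k n r s N = (χ : Coloring k N r s) → MonoClique χ n

-- R_k(n;r,s) > N, where R_k(n;r,s) is the minimum N with Arrows k n r s N: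
-- literally, no M ≤ N has the arrow property.
RamseyExceeds : (k n r s N : ℕ) → Set
RamseyExceeds k n r s N = (M : ℕ) → M ≤ N → ¬ Arrows k n r s M

module Submission where

-- Erdős–Hajnal stepping up.  Read the vertices 0 … 2^N − 1 as N-bit strings and let
-- δ(a, b) be the highest bit in which a and b differ; for a < b < c one has
-- δ(a, b) ≠ δ(b, c) and δ(a, c) = max (δ(a, b), δ(b, c)).  A (k+1)-set v₀ < … < v_k gets
-- the χ-colour of the k-set {δ(vᵢ, vᵢ₊₁)} when this sequence is monotone, and otherwise one
-- of two disjoint s-sets of colours C↑, C↓ according to whether it starts with an ascent or
-- a descent.  A colour c common to a (2n−1)-clique misses C↑ or C↓, say C↑; then every window
-- of k consecutive δ's that starts with an ascent is increasing, so either the first n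
-- consecutive δ's decrease or, from the first ascent on, they all increase.  Either way n
-- consecutive δ's are monotone, and by the max property every k-subset of their values is the
-- δ-sequence of k+1 of the vertices: these n values form a χ-monochromatic n-clique.

open import Defs
open import Data.Nat
  using (ℕ; zero; suc; _+_; _*_; _∸_; _^_; _≤_; _<_; _>_; _⊔_; ⌊_/2⌋; z≤n; s≤s; z<s; s<s; _≟_; _<?_)
open import Data.Nat.Properties
open import Data.Fin using (Fin; zero; suc; toℕ; fromℕ<)
open import Data.Fin.Properties using (toℕ-fromℕ<)
open import Data.Fin.Subset using (Subset; ∣_∣; _∈_; _∉_; _⊆_; inside; outside) renaming (⊥ to ∅)
open import Data.Fin.Subset.Properties using (∉⊥; ∣⊥∣≡0; ⊆-antisym)
open import Data.Vec using ([]; _∷_; here; there)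
open import Data.List using (List; []; _∷_; length; map; foldr; filter; take; drop; applyUpTo)
open import Data.List.Properties using (length-map; length-applyUpTo; length-take; take-all; drop-[])
open import Data.List.Membership.Propositional using () renaming (_∈_ to _∈ₗ_)
open import Data.List.Membership.Propositional.Properties
  using (∈-map⁺; ∈-map⁻; ∈-filter⁺; ∈-filter⁻; ∈-applyUpTo⁻)
open import Data.List.Membership.DecPropositional _≟_ using () renaming (_∈?_ to _∈ₗ?_)
open import Data.List.Relation.Unary.Any using (here; there)
open import Data.List.Relation.Unary.All as All using (All; []; _∷_)
import Data.List.Relation.Unary.All.Properties as All
open import Data.List.Relation.Unary.AllPairs as AllPairs using (AllPairs; []; _∷_)
import Data.List.Relation.Unary.AllPairs.Properties as AllPairs
open import Data.List.Relation.Unary.Linked as Linked using (Linked; []; [-]; _∷_)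
open import Data.List.Relation.Unary.Linked.Properties using (Linked⇒AllPairs; AllPairs⇒Linked)
open import Data.List.Relation.Unary.Unique.Propositional using (Unique)
open import Data.List.Relation.Binary.Sublist.Propositional
  using ([]; _∷_; _∷ʳ_; lookup; ⊆-trans) renaming (_⊆_ to _⊑_)
open import Data.List.Relation.Binary.Sublist.Propositional.Properties
  using (All-resp-⊆; take-⊆; drop-⊆; filter-⊆)
open import Data.Product using (∃-syntax; _×_; _,_; proj₁; proj₂)
open import Data.Sum as Sum using (_⊎_; inj₁; inj₂; [_,_]′)
open import Data.Empty using (⊥; ⊥-elim)
open import Function using (_∘_; id)
open import Level using (0ℓ)
open import Relation.Binary using (Rel; Transitive; tri<; tri≈; tri>) renaming (Decidable to Decidable₂)
open import Relation.Binary.PropositionalEquality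
  using (_≡_; _≢_; refl; sym; trans; cong; cong₂; subst)
open import Relation.Nullary using (¬_; yes; no; contradiction)
open import Relation.Nullary.Decidable using (_⊎-dec_)
open import Relation.Unary using (Decidable)

private
  variable
    A : Set
    R S : Rel A 0ℓ
    xs ys : List A
    a m : ℕ
    l : List ℕ
    p : Subset m
    x : Fin m

-- Subsets of Fin m as strictly increasing lists of naturals

-- Entries a ≥ m are silently ignored.
insert : ℕ → Subset m → Subset m
insert _       []      = []
insert zero    (_ ∷ p) = inside ∷ p
insert (suc a) (b ∷ p) = b ∷ insert a p

∈-insert⁻ : x ∈ insert a p → toℕ x ≡ a ⊎ x ∈ p
∈-insert⁻ {x = zero}  {zero}  {_ ∷ p} here        = inj₁ refl
∈-insert⁻ {x = zero}  {suc a} {_ ∷ p} here        = inj₂ here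
∈-insert⁻ {x = suc x} {zero}  {_ ∷ p} (there x∈p) = inj₂ (there x∈p)
∈-insert⁻ {x = suc x} {suc a} {_ ∷ p} (there x∈)  = Sum.map (cong suc) there (∈-insert⁻ x∈)

x∈insert[x] : ∀ (x : Fin m) p → x ∈ insert (toℕ x) p
x∈insert[x] zero    (_ ∷ p) = here
x∈insert[x] (suc x) (_ ∷ p) = there (x∈insert[x] x p)

∈-insert⁺ : x ∈ p → x ∈ insert a p
∈-insert⁺ {a = zero}  here        = here
∈-insert⁺ {a = suc a} here        = here
∈-insert⁺ {a = zero}  (there x∈p) = there x∈p
∈-insert⁺ {a = suc a} (there x∈p) = there (∈-insert⁺ x∈p)

∣insert∣ : ∀ (x : Fin m) p → x ∉ p → ∣ insert (toℕ x) p ∣ ≡ suc ∣ p ∣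
∣insert∣ zero    (inside ∷ p)  x∉p = contradiction here x∉p
∣insert∣ zero    (outside ∷ p) x∉p = refl
∣insert∣ (suc x) (inside ∷ p)  x∉p = cong suc (∣insert∣ x p (x∉p ∘ there))
∣insert∣ (suc x) (outside ∷ p) x∉p = ∣insert∣ x p (x∉p ∘ there)

fromList : List ℕ → Subset m
fromList = foldr insert ∅

∈-fromList⁻ : x ∈ fromList l → toℕ x ∈ₗ l
∈-fromList⁻ {l = []}    x∈ = contradiction x∈ ∉⊥
∈-fromList⁻ {l = a ∷ l} x∈ with ∈-insert⁻ x∈
... | inj₁ x≡a = here x≡a
... | inj₂ x∈′ = there (∈-fromList⁻ x∈′)

∈-fromList⁺ : toℕ x ∈ₗ l → x ∈ fromList l
∈-fromList⁺ {x = x} {l = a ∷ l} (here refl) = x∈insert[x] x (fromList l)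
∈-fromList⁺ (there x∈l) = ∈-insert⁺ (∈-fromList⁺ x∈l)

∣fromList∣ : Unique l → All (_< m) l → ∣ fromList {m} l ∣ ≡ length l
∣fromList∣ {[]}    {m} _ _ = ∣⊥∣≡0 m
∣fromList∣ {a ∷ l} (a∉l ∷ l!) (a<m ∷ l<m) with fromℕ< a<m | toℕ-fromℕ< a<m
... | x | refl = trans (∣insert∣ x (fromList l) (λ x∈ → All.lookup a∉l (∈-fromList⁻ x∈) refl))
                       (cong suc (∣fromList∣ l! l<m))

elements : Subset m → List ℕ
elements []            = []
elements (inside ∷ p)  = 0 ∷ map suc (elements p)
elements (outside ∷ p) = map suc (elements p)

∈-elements⁺ : x ∈ p → toℕ x ∈ₗ elements p
∈-elements⁺ {p = inside ∷ p}  here        = here refl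
∈-elements⁺ {p = inside ∷ p}  (there x∈p) = there (∈-map⁺ suc (∈-elements⁺ x∈p))
∈-elements⁺ {p = outside ∷ p} (there x∈p) = ∈-map⁺ suc (∈-elements⁺ x∈p)

∈-elements⁻ : toℕ x ∈ₗ elements p → x ∈ p
∈-elements⁻ {x = zero}  {p = inside ∷ p}  _ = here
∈-elements⁻ {x = zero}  {p = outside ∷ p} x∈ with ∈-map⁻ suc x∈
... | _ , _ , ()
∈-elements⁻ {x = suc x} {p = inside ∷ p}  (there x∈) with ∈-map⁻ suc x∈
... | _ , y∈ , refl = there (∈-elements⁻ y∈)
∈-elements⁻ {x = suc x} {p = outside ∷ p} x∈ with ∈-map⁻ suc x∈
... | _ , y∈ , refl = there (∈-elements⁻ y∈)

elements-< : (p : Subset m) → All (_< m) (elements p)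
elements-< []            = []
elements-< (inside ∷ p)  = z<s ∷ All.map⁺ (All.map s<s (elements-< p))
elements-< (outside ∷ p) = All.map⁺ (All.map s<s (elements-< p))

elements-sorted : (p : Subset m) → AllPairs _<_ (elements p)
elements-sorted []            = []
elements-sorted (inside ∷ p)  = All.map⁺ (All.universal (λ _ → z<s) (elements p))
                              ∷ AllPairs.map⁺ (AllPairs.map s<s (elements-sorted p))
elements-sorted (outside ∷ p) = AllPairs.map⁺ (AllPairs.map s<s (elements-sorted p))

length-elements : (p : Subset m) → length (elements p) ≡ ∣ p ∣
length-elements []            = refl
length-elements (inside ∷ p)  = cong suc (trans (length-map suc (elements p)) (length-elements p))
length-elements (outside ∷ p) = trans (length-map suc (elements p)) (length-elements p)

sorted-unique : ∀ {xs ys} → AllPairs _<_ xs → AllPairs _<_ ys →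
                (∀ {z} → z ∈ₗ xs → z ∈ₗ ys) → (∀ {z} → z ∈ₗ ys → z ∈ₗ xs) → xs ≡ ys
sorted-unique [] [] _ _ = refl
sorted-unique [] (_ ∷ _) _ ys⊆xs with () ← ys⊆xs (here refl)
sorted-unique (_ ∷ _) [] xs⊆ys _ with () ← xs⊆ys (here refl)
sorted-unique {x ∷ xs} {y ∷ ys} (x<xs ∷ xs↗) (y<ys ∷ ys↗) xs⊆ys ys⊆xs =
  cong₂ _∷_ x≡y (sorted-unique xs↗ ys↗ (tail-⊆ x≡y x<xs xs⊆ys) (tail-⊆ (sym x≡y) y<ys ys⊆xs))
  where
  head-≤ : ∀ {u us z} → All (u <_) us → z ∈ₗ u ∷ us → u ≤ z
  head-≤ _    (here refl) = ≤-refl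
  head-≤ u<us (there z∈)  = <⇒≤ (All.lookup u<us z∈)

  x≡y : x ≡ y
  x≡y = ≤-antisym (head-≤ x<xs (ys⊆xs (here refl))) (head-≤ y<ys (xs⊆ys (here refl)))

  tail-⊆ : ∀ {u v us vs} → u ≡ v → All (u <_) us →
           (∀ {z} → z ∈ₗ u ∷ us → z ∈ₗ v ∷ vs) → ∀ {z} → z ∈ₗ us → z ∈ₗ vs
  tail-⊆ refl u<us ⊆ z∈ with ⊆ (there z∈)
  ... | here refl = contradiction (All.lookup u<us z∈) (<-irrefl refl)
  ... | there z∈′ = z∈′

elements-fromList : AllPairs _<_ l → All (_< m) l → elements (fromList {m} l) ≡ l
elements-fromList {l} {m} l↗ l<m = sorted-unique (elements-sorted (fromList l)) l↗ sound complete
  where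
  sound : ∀ {y} → y ∈ₗ elements (fromList {m} l) → y ∈ₗ l
  sound y∈ with fromℕ< (All.lookup (elements-< (fromList l)) y∈)
              | toℕ-fromℕ< (All.lookup (elements-< (fromList l)) y∈)
  ... | x | refl = ∈-fromList⁻ (∈-elements⁻ y∈)

  complete : ∀ {y} → y ∈ₗ l → y ∈ₗ elements (fromList {m} l)
  complete y∈ with fromℕ< (All.lookup l<m y∈) | toℕ-fromℕ< (All.lookup l<m y∈)
  ... | x | refl = ∈-elements⁺ (∈-fromList⁺ {x = x} y∈)

fromList-filter-elements : ∀ {e : Subset m} → e ⊆ fromList l →
                           fromList (filter (_∈ₗ? elements e) l) ≡ e
fromList-filter-elements {l = l} {e} e⊆ = ⊆-antisym sound complete
  where
  sound : fromList (filter (_∈ₗ? elements e) l) ⊆ e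
  sound x∈ = ∈-elements⁻ (proj₂ (∈-filter⁻ (_∈ₗ? elements e) {xs = l} (∈-fromList⁻ x∈)))

  complete : e ⊆ fromList (filter (_∈ₗ? elements e) l)
  complete x∈ =
    ∈-fromList⁺ (∈-filter⁺ (_∈ₗ? elements e) (∈-fromList⁻ {l = l} (e⊆ x∈)) (∈-elements⁺ x∈))

-- Chains, windows and long monotone runs

AllPairs-resp-⊑ : xs ⊑ ys → AllPairs R ys → AllPairs R xs
AllPairs-resp-⊑ []         []           = []
AllPairs-resp-⊑ (_ ∷ʳ τ)   (_ ∷ ys↗)    = AllPairs-resp-⊑ τ ys↗
AllPairs-resp-⊑ (refl ∷ τ) (y~ys ∷ ys↗) = All-resp-⊆ τ y~ys ∷ AllPairs-resp-⊑ τ ys↗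

Linked-resp-⊑ : Transitive R → xs ⊑ ys → Linked R ys → Linked R xs
Linked-resp-⊑ trans τ = AllPairs⇒Linked ∘ AllPairs-resp-⊑ τ ∘ Linked⇒AllPairs trans

Linked-take : ∀ n → Linked R xs → Linked R (take n xs)
Linked-take zero          _          = []
Linked-take (suc n)       []         = []
Linked-take (suc zero)    [-]        = [-]
Linked-take (suc (suc n)) [-]        = [-]
Linked-take (suc zero)    (_ ∷ _)    = [-]
Linked-take (suc (suc n)) (r ∷ rest) = r ∷ Linked-take (suc n) rest

length-drop-≥ : ∀ i {n} → i + n ≤ length xs → n ≤ length (drop i xs)
length-drop-≥               zero    i+n≤       = i+n≤
length-drop-≥ {xs = _ ∷ xs} (suc i) (s≤s i+n≤) = length-drop-≥ i i+n≤

length-take-drop : ∀ i n (xs : List A) → i + n ≤ length xs → length (take n (drop i xs)) ≡ n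
length-take-drop i n xs i+n≤ = trans (length-take n (drop i xs)) (m≤n⇒m⊓n≡m (length-drop-≥ i i+n≤))

take-drop-⊑ : ∀ i n (xs : List A) → take n (drop i xs) ⊑ xs
take-drop-⊑ i n xs = ⊆-trans (take-⊆ n (drop i xs)) (drop-⊆ i xs)

StartsWith : Rel A 0ℓ → List A → Set
StartsWith R (a ∷ b ∷ _) = R a b
StartsWith R _           = ⊥

startsWith? : Decidable₂ R → Decidable (StartsWith R)
startsWith? R? []          = no λ ()
startsWith? R? (_ ∷ [])    = no λ ()
startsWith? R? (a ∷ b ∷ _) = R? a b

StartsWith-Linked : StartsWith R xs → Linked S xs → StartsWith S xs
StartsWith-Linked {xs = _ ∷ _ ∷ _} _ (Sab ∷ _) = Sab

StartForcesChain : Rel A 0ℓ → List A → Set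
StartForcesChain S ys = StartsWith S ys → Linked S ys

Windows : ℕ → (List A → Set) → List A → Set
Windows w P xs = ∀ i → i + w ≤ length xs → P (take w (drop i xs))

Windows-drop : ∀ {w} {P : List A → Set} y → Windows w P xs → Windows w P (drop y xs)
Windows-drop                       zero    win = win
Windows-drop {xs = []}             (suc y) win = win
Windows-drop {xs = _ ∷ xs} {P = P} (suc y) win =
  Windows-drop {P = P} y (λ i i+w≤ → win (suc i) (s≤s i+w≤))

-- Consecutive windows overlap in at least two entries, so an S-step at the start of one
-- window is inherited by the next.
Windows-propagate : ∀ {w} → 3 ≤ w → Windows w (StartForcesChain S) xs → w ≤ length xs →
                    StartForcesChain S xs
Windows-propagate {xs = a ∷ b ∷ []}                  _   _   _  Sab = Sab ∷ [-]
Windows-propagate {xs = a ∷ b ∷ c ∷ rest} {w} 3≤w@(s≤s (s≤s (s≤s _))) win w≤ Sab =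
  [ (λ w≤′ → Sab ∷ Windows-propagate 3≤w (λ i i+w≤ → win (suc i) (s≤s i+w≤)) w≤′
                                      (Linked.head (Linked.tail window)))
  , (λ len<w → subst (Linked _) (take-all w (a ∷ b ∷ c ∷ rest) len<w) window)
  ]′ (≤-<-connex w (length (b ∷ c ∷ rest)))
  where
  window : Linked _ (take w (a ∷ b ∷ c ∷ rest))
  window = win 0 w≤ Sab

initialRun⊎turn : ∀ m xs → Linked (λ a b → R a b ⊎ S a b) xs →
                  Linked R (take (suc m) xs) ⊎ ∃[ y ] y < m × StartsWith S (drop y xs)
initialRun⊎turn zero    []           _ = inj₁ []
initialRun⊎turn zero    (_ ∷ _)      _ = inj₁ [-]
initialRun⊎turn (suc m) []           _ = inj₁ []
initialRun⊎turn (suc m) (_ ∷ [])     _ = inj₁ [-]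
initialRun⊎turn (suc m) (a ∷ b ∷ xs) (inj₂ Sab ∷ _) = inj₂ (0 , z<s , Sab)
initialRun⊎turn (suc m) (a ∷ b ∷ xs) (inj₁ Rab ∷ steps) with initialRun⊎turn m (b ∷ xs) steps
... | inj₁ run              = inj₁ (Rab ∷ run)
... | inj₂ (y , y<m , turn) = inj₂ (suc y , s<s y<m , turn)

chain-infix : ∀ {w m} → 3 ≤ w → w ≤ m → m + m ≤ 2 + length xs →
              Linked (λ a b → R a b ⊎ S a b) xs → Windows w (StartForcesChain S) xs →
              ∃[ i ] i + m ≤ length xs × (Linked R (take m (drop i xs)) ⊎ Linked S (take m (drop i xs)))
chain-infix {m = zero} (s≤s _) () _ _ _
chain-infix {xs = xs} {R = R} {S = S} {w = w} {m = suc m} 3≤w w≤1+m 2m≤ steps win =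
  pick (initialRun⊎turn m xs steps)
  where
  m+m≤len : m + m ≤ length xs
  m+m≤len = ≤-pred (subst (_≤ suc (length xs)) (+-suc m m) (≤-pred 2m≤))

  pick : Linked R (take (suc m) xs) ⊎ ∃[ y ] y < m × StartsWith S (drop y xs) →
         ∃[ i ] i + suc m ≤ length xs ×
                (Linked R (take (suc m) (drop i xs)) ⊎ Linked S (take (suc m) (drop i xs)))
  pick (inj₁ run) = 0 , ≤-trans (+-monoˡ-≤ m 1≤m) m+m≤len , inj₁ run
    where
    1≤m : 1 ≤ m
    1≤m = ≤-trans (s≤s z≤n) (≤-pred (≤-trans 3≤w w≤1+m))
  pick (inj₂ (y , y<m , turn)) =
    y , y+1+m≤len ,
    inj₂ (Linked-take (suc m)
           (Windows-propagate 3≤w (Windows-drop {P = StartForcesChain S} y win) w≤len turn))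
    where
    y+1+m≤len : y + suc m ≤ length xs
    y+1+m≤len = ≤-trans (≤-reflexive (+-suc y m)) (≤-trans (+-monoˡ-≤ m y<m) m+m≤len)
    w≤len : w ≤ length (drop y xs)
    w≤len = ≤-trans w≤1+m (length-drop-≥ y y+1+m≤len)

-- Consecutive values of an ultrametric-like function

consecutive : (A → A → ℕ) → List A → List ℕ
consecutive f (a ∷ b ∷ xs) = f a b ∷ consecutive f (b ∷ xs)
consecutive f _            = []

module _ (f : A → A → ℕ) where

  length-consecutive : ∀ a xs → length (consecutive f (a ∷ xs)) ≡ length xs
  length-consecutive a []       = refl
  length-consecutive a (b ∷ xs) = cong suc (length-consecutive b xs)

  length-consecutive-≥ : ∀ xs → length xs ≤ suc (length (consecutive f xs))
  length-consecutive-≥ []       = z≤n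
  length-consecutive-≥ (a ∷ xs) = s≤s (≤-reflexive (sym (length-consecutive a xs)))

  length-consecutive-< : ∀ xs {m} → 0 < m → m ≤ length (consecutive f xs) → m < length xs
  length-consecutive-< []       0<m m≤0 = contradiction (<-≤-trans 0<m m≤0) (λ ())
  length-consecutive-< (a ∷ xs) _   m≤  = s≤s (subst (_ ≤_) (length-consecutive a xs) m≤)

  consecutive-drop : ∀ i xs → consecutive f (drop i xs) ≡ drop i (consecutive f xs)
  consecutive-drop zero    xs           = refl
  consecutive-drop (suc i) []           = refl
  consecutive-drop (suc i) (a ∷ [])     = cong (consecutive f) (drop-[] i)
  consecutive-drop (suc i) (a ∷ b ∷ xs) = consecutive-drop i (b ∷ xs)

  consecutive-take : ∀ n xs → consecutive f (take (suc n) xs) ≡ take n (consecutive f xs)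
  consecutive-take zero    []           = refl
  consecutive-take zero    (a ∷ xs)     = refl
  consecutive-take (suc n) []           = refl
  consecutive-take (suc n) (a ∷ [])     = refl
  consecutive-take (suc n) (a ∷ b ∷ xs) = cong (f a b ∷_) (consecutive-take n (b ∷ xs))

  consecutive-infix : ∀ i n xs →
                      consecutive f (take (suc n) (drop i xs)) ≡ take n (drop i (consecutive f xs))
  consecutive-infix i n xs =
    trans (consecutive-take n (drop i xs)) (cong (take n) (consecutive-drop i xs))

Monotone : List ℕ → Set
Monotone xs = Linked _<_ xs ⊎ Linked _>_ xs

monotone? : Decidable Monotone
monotone? xs = Linked.linked? _<?_ xs ⊎-dec Linked.linked? (λ a b → b <? a) xs

Monotone-resp-⊑ : ∀ {xs ys} → xs ⊑ ys → Monotone ys → Monotone xs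
Monotone-resp-⊑ τ = Sum.map (Linked-resp-⊑ <-trans τ) (Linked-resp-⊑ (λ a>b b>c → <-trans b>c a>b) τ)

Monotone⇒Unique : ∀ {xs} → Monotone xs → Unique xs
Monotone⇒Unique (inj₁ ↑) = AllPairs.map <⇒≢ (Linked⇒AllPairs <-trans ↑)
Monotone⇒Unique (inj₂ ↓) = AllPairs.map >⇒≢ (Linked⇒AllPairs (λ a>b b>c → <-trans b>c a>b) ↓)

≢⇒<⊎> : ∀ {a b} → a ≢ b → a < b ⊎ a > b
≢⇒<⊎> {a} {b} a≢b with <-cmp a b
... | tri< a<b _ _ = inj₁ a<b
... | tri≈ _ a≡b _ = contradiction a≡b a≢b
... | tri> _ _ a>b = inj₂ a>b

-- Along vertices with increasing consecutive values, f vᵢ vⱼ is the value on the last step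
-- into vⱼ; with decreasing values it is the value on the first step out of vᵢ.  Either way
-- every sublist of the consecutive values is the consecutive values of a sublist of vertices.
module Lifting {_≺_ : Rel A 0ℓ} (f : A → A → ℕ)
               (f-⊔ : ∀ {a b c} → a ≺ b → b ≺ c → f a c ≡ f a b ⊔ f b c) where

  Lift : List ℕ → List A → Set
  Lift σ vs = ∃[ us ] us ⊑ vs × consecutive f us ≡ σ × length us ≡ suc (length σ)

  first-step-≤ : ∀ {b c rest t} → AllPairs _≺_ (b ∷ c ∷ rest) → t ∈ₗ c ∷ rest → f b c ≤ f b t
  first-step-≤ _ (here refl) = ≤-refl
  first-step-≤ {b} {c} ((b≺c ∷ _) ∷ (c≺rest ∷ _)) (there t∈) =
    subst (f b c ≤_) (sym (f-⊔ b≺c (All.lookup c≺rest t∈))) (m≤m⊔n _ _)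

  ≤-first-step : ∀ {b c rest t} → AllPairs _≺_ (b ∷ c ∷ rest) →
                 Linked _>_ (consecutive f (b ∷ c ∷ rest)) → t ∈ₗ c ∷ rest → f b t ≤ f b c
  ≤-first-step _ _ (here refl) = ≤-refl
  ≤-first-step {rest = _ ∷ _} ((b≺c ∷ _) ∷ c↗@(c≺rest ∷ _)) (fcd<fbc ∷ dec) (there t∈) =
    subst (_≤ _) (sym (f-⊔ b≺c (All.lookup c≺rest t∈)))
      (⊔-lub ≤-refl (≤-trans (≤-first-step c↗ dec t∈) (<⇒≤ fcd<fbc)))

  increasing-skip : ∀ {w b rest t} → AllPairs _≺_ (w ∷ b ∷ rest) →
                    Linked _<_ (consecutive f (w ∷ b ∷ rest)) → t ∈ₗ rest → f w t ≡ f b t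
  increasing-skip {rest = _ ∷ _} ((w≺b ∷ _) ∷ b↗@(b≺rest ∷ _)) (fwb<fbc ∷ _) t∈ =
    trans (f-⊔ w≺b (All.lookup b≺rest t∈))
      (m≤n⇒m⊔n≡n (<⇒≤ (<-≤-trans fwb<fbc (first-step-≤ b↗ t∈))))

  decreasing-skip : ∀ {w b rest v} → AllPairs _≺_ (w ∷ b ∷ rest) →
                    Linked _>_ (consecutive f (w ∷ b ∷ rest)) → v ∈ₗ b ∷ rest → f w v ≡ f w b
  decreasing-skip _ _ (here refl) = refl
  decreasing-skip {rest = _ ∷ _} ((w≺b ∷ _) ∷ b↗@(b≺rest ∷ _)) (fbc<fwb ∷ dec) (there v∈) =
    trans (f-⊔ w≺b (All.lookup b≺rest v∈))
      (m≥n⇒m⊔n≡m (<⇒≤ (≤-<-trans (≤-first-step b↗ dec v∈) fbc<fwb)))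

  lift-increasing : ∀ {w ws σ} → AllPairs _≺_ (w ∷ ws) → Linked _<_ (consecutive f (w ∷ ws)) →
                    σ ⊑ consecutive f (w ∷ ws) → ∃[ us ] us ⊑ ws × consecutive f (w ∷ us) ≡ σ
  lift-increasing {ws = []} _ _ [] = [] , [] , refl
  lift-increasing {w} {b ∷ _} (_ ∷ b↗) inc (refl ∷ τ) with lift-increasing b↗ (Linked.tail inc) τ
  ... | us , us⊑ , eq = b ∷ us , refl ∷ us⊑ , cong (f w b ∷_) eq
  lift-increasing {w} {b ∷ _} w↗@(_ ∷ b↗) inc (_ ∷ʳ τ) with lift-increasing b↗ (Linked.tail inc) τ
  ... | []     , us⊑ , eq = [] , b ∷ʳ us⊑ , eq
  ... | t ∷ us , us⊑ , eq = t ∷ us , b ∷ʳ us⊑ ,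
    trans (cong (_∷ consecutive f (t ∷ us)) (increasing-skip w↗ inc (lookup us⊑ (here refl)))) eq

  lift-decreasing : ∀ {w ws σ} → AllPairs _≺_ (w ∷ ws) → Linked _>_ (consecutive f (w ∷ ws)) →
                    σ ⊑ consecutive f (w ∷ ws) → Lift σ (w ∷ ws)
  lift-decreasing {w} {[]} _ _ [] = w ∷ [] , refl ∷ [] , refl , refl
  lift-decreasing {w} {_ ∷ _} (_ ∷ b↗) dec (_ ∷ʳ τ) with lift-decreasing b↗ (Linked.tail dec) τ
  ... | us , us⊑ , eq , len = us , w ∷ʳ us⊑ , eq , len
  lift-decreasing {w} {_ ∷ _} w↗@(_ ∷ b↗) dec (refl ∷ τ) with lift-decreasing b↗ (Linked.tail dec) τ
  ... | v ∷ us , us⊑ , eq , len = w ∷ v ∷ us , refl ∷ us⊑ ,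
    cong₂ _∷_ (decreasing-skip w↗ dec (lookup us⊑ (here refl))) eq , cong suc len

  lift : ∀ {w ws σ} → AllPairs _≺_ (w ∷ ws) → Monotone (consecutive f (w ∷ ws)) →
         σ ⊑ consecutive f (w ∷ ws) → Lift σ (w ∷ ws)
  lift {w} w↗ (inj₁ inc) τ with lift-increasing w↗ inc τ
  ... | us , us⊑ , eq =
    w ∷ us , refl ∷ us⊑ , eq , cong suc (trans (sym (length-consecutive f w us)) (cong length eq))
  lift w↗ (inj₂ dec) τ = lift-decreasing w↗ dec τ

-- The highest differing bit

highestDifferingBit : ℕ → ℕ → ℕ → ℕ
highestDifferingBit zero    a b = 0
highestDifferingBit (suc n) a b with ⌊ a /2⌋ ≟ ⌊ b /2⌋
... | yes _ = 0
... | no  _ = suc (highestDifferingBit n ⌊ a /2⌋ ⌊ b /2⌋)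

⌊n/2⌋<m : ∀ n m → n < m + m → ⌊ n /2⌋ < m
⌊n/2⌋<m zero          (suc m) _          = z<s
⌊n/2⌋<m (suc zero)    (suc m) _          = z<s
⌊n/2⌋<m (suc (suc n)) (suc m) (s≤s n<2m) =
  s≤s (⌊n/2⌋<m n m (≤-pred (subst (suc (suc n) ≤_) (+-suc m m) n<2m)))

⌊n/2⌋<2^m : ∀ {n} m → n < 2 ^ suc m → ⌊ n /2⌋ < 2 ^ m
⌊n/2⌋<2^m {n} m n< = ⌊n/2⌋<m n (2 ^ m) (subst (n <_) (cong (2 ^ m +_) (+-identityʳ (2 ^ m))) n<)

highestDifferingBit-⊔ : ∀ n {a b c} → a ≤ b → b ≤ c →
                        highestDifferingBit n a c ≡ highestDifferingBit n a b ⊔ highestDifferingBit n b c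
highestDifferingBit-⊔ zero _ _ = refl
highestDifferingBit-⊔ (suc n) {a} {b} {c} a≤b b≤c
  with ⌊ a /2⌋ ≟ ⌊ c /2⌋ | ⌊ a /2⌋ ≟ ⌊ b /2⌋ | ⌊ b /2⌋ ≟ ⌊ c /2⌋
... | yes _   | yes _   | yes _   = refl
... | yes a~c | no  a≁b | _       =
  contradiction (≤-antisym (⌊n/2⌋-mono a≤b) (subst (_ ≤_) (sym a~c) (⌊n/2⌋-mono b≤c))) a≁b
... | yes a~c | yes _   | no  b≁c =
  contradiction (≤-antisym (⌊n/2⌋-mono b≤c) (subst (_≤ _) a~c (⌊n/2⌋-mono a≤b))) b≁c
... | no  a≁c | yes a~b | yes b~c = contradiction (trans a~b b~c) a≁c
... | no  _   | yes a~b | no  _   = cong (λ z → suc (highestDifferingBit n z ⌊ c /2⌋)) a~b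
... | no  _   | no  _   | yes b~c = cong (λ z → suc (highestDifferingBit n ⌊ a /2⌋ z)) (sym b~c)
... | no  _   | no  _   | no  _   =
  cong suc (highestDifferingBit-⊔ n (⌊n/2⌋-mono a≤b) (⌊n/2⌋-mono b≤c))

highestDifferingBit-≢ : ∀ n {a b c} → a < b → b < c → c < 2 ^ n →
                        highestDifferingBit n a b ≢ highestDifferingBit n b c
highestDifferingBit-≢ zero    _ () (s≤s z≤n)
highestDifferingBit-≢ (suc n) {a} {b} {c} a<b b<c c< with ⌊ a /2⌋ ≟ ⌊ b /2⌋ | ⌊ b /2⌋ ≟ ⌊ c /2⌋
... | yes a~b | yes b~c = λ _ → <-irrefl (trans a~b b~c) (⌊n/2⌋-mono (≤-trans (s≤s a<b) b<c))
... | yes _   | no  _   = λ ()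
... | no  _   | yes _   = λ ()
... | no  a≁b | no  b≁c =
  highestDifferingBit-≢ n (≤∧≢⇒< (⌊n/2⌋-mono (<⇒≤ a<b)) a≁b)
                          (≤∧≢⇒< (⌊n/2⌋-mono (<⇒≤ b<c)) b≁c)
                          (⌊n/2⌋<2^m n c<)
  ∘ suc-injective

highestDifferingBit-< : ∀ n {a b} → a ≢ b → a < 2 ^ n → b < 2 ^ n → highestDifferingBit n a b < n
highestDifferingBit-< zero    {zero}  {zero}  a≢b _ _ = contradiction refl a≢b
highestDifferingBit-< zero    {suc _}         _ (s≤s ()) _
highestDifferingBit-< zero    {zero}  {suc _} _ _ (s≤s ())
highestDifferingBit-< (suc n) {a} {b} a≢b a< b< with ⌊ a /2⌋ ≟ ⌊ b /2⌋
... | yes _   = z<s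
... | no  a≁b = s<s (highestDifferingBit-< n a≁b (⌊n/2⌋<2^m n a<) (⌊n/2⌋<2^m n b<))

consecutive-highestDifferingBit-≢ : ∀ n {vs} → AllPairs _<_ vs → All (_< 2 ^ n) vs →
                                    Linked _≢_ (consecutive (highestDifferingBit n) vs)
consecutive-highestDifferingBit-≢ n {[]}            _ _ = []
consecutive-highestDifferingBit-≢ n {_ ∷ []}        _ _ = []
consecutive-highestDifferingBit-≢ n {_ ∷ _ ∷ []}    _ _ = [-]
consecutive-highestDifferingBit-≢ n {_ ∷ _ ∷ _ ∷ _}
  ((a<b ∷ _) ∷ vs↗@((b<c ∷ _) ∷ _)) (_ ∷ vs<@(_ ∷ c< ∷ _)) =
  highestDifferingBit-≢ n a<b b<c c< ∷ consecutive-highestDifferingBit-≢ n vs↗ vs<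

consecutive-highestDifferingBit-< : ∀ n {vs} → AllPairs _<_ vs → All (_< 2 ^ n) vs →
                                    All (_< n) (consecutive (highestDifferingBit n) vs)
consecutive-highestDifferingBit-< n {[]}        _ _ = []
consecutive-highestDifferingBit-< n {_ ∷ []}    _ _ = []
consecutive-highestDifferingBit-< n {_ ∷ _ ∷ _} ((a<b ∷ _) ∷ vs↗) (a< ∷ vs<@(b< ∷ _)) =
  highestDifferingBit-< n (<⇒≢ a<b) a< b< ∷ consecutive-highestDifferingBit-< n vs↗ vs<

-- The stepped-up colouring

colour-resp-≡ : ∀ {k N r s} (χ : Coloring k N r s) {e e′ : Subset N} (h : ∣ e ∣ ≡ k) (h′ : ∣ e′ ∣ ≡ k) →
                e ≡ e′ → colour χ e h ≡ colour χ e′ h′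
colour-resp-≡ χ h h′ refl = cong (colour χ _) (≡-irrelevant h h′)

module SteppingUp {k N r s : ℕ} (χ : Coloring k N r s)
                  (C↑ C↓ : Subset r) (∣C↑∣≡s : ∣ C↑ ∣ ≡ s) (∣C↓∣≡s : ∣ C↓ ∣ ≡ s) where

  δ : ℕ → ℕ → ℕ
  δ = highestDifferingBit N

  fallback : List ℕ → Subset r
  fallback ds with startsWith? _<?_ ds
  ... | yes _ = C↑
  ... | no  _ = C↓

  -- The cardinality test only supplies χ with its proof argument: it succeeds on the
  -- monotone δ-sequences of (k+1)-sets.
  colourOf : List ℕ → Subset r
  colourOf ds with monotone? ds | ∣ fromList {N} ds ∣ ≟ k
  ... | yes _ | yes h = colour χ (fromList ds) h
  ... | yes _ | no  _ = fallback ds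
  ... | no  _ | _     = fallback ds

  ∣fallback∣ : ∀ ds → ∣ fallback ds ∣ ≡ s
  ∣fallback∣ ds with startsWith? _<?_ ds
  ... | yes _ = ∣C↑∣≡s
  ... | no  _ = ∣C↓∣≡s

  ∣colourOf∣ : ∀ ds → ∣ colourOf ds ∣ ≡ s
  ∣colourOf∣ ds with monotone? ds | ∣ fromList {N} ds ∣ ≟ k
  ... | yes _ | yes h = colour-size χ (fromList ds) h
  ... | yes _ | no  _ = ∣fallback∣ ds
  ... | no  _ | _     = ∣fallback∣ ds

  stepUp : ∀ {M} → Coloring (suc k) M r s
  stepUp = record
    { colour      = λ e _ → colourOf (consecutive δ (elements e))
    ; colour-size = λ e _ → ∣colourOf∣ (consecutive δ (elements e))
    }

  colourOf-monotone : ∀ {ds} → Monotone ds → (h : ∣ fromList ds ∣ ≡ k) →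
                      colourOf ds ≡ colour χ (fromList ds) h
  colourOf-monotone {ds} ds↕ h with monotone? ds | ∣ fromList {N} ds ∣ ≟ k
  ... | yes _  | yes h′ = colour-resp-≡ χ h′ h refl
  ... | yes _  | no  ¬h = contradiction h ¬h
  ... | no  ¬↕ | _      = contradiction ds↕ ¬↕

  up-down-⊥ : ∀ {ds} → StartsWith _<_ ds → StartsWith _>_ ds → ⊥
  up-down-⊥ {_ ∷ _ ∷ _} = <-asym

  fallback-increasing : ∀ {c ds} → c ∈ fallback ds → c ∉ C↑ → ¬ StartsWith _<_ ds
  fallback-increasing {ds = ds} c∈ c∉C↑ with startsWith? _<?_ ds
  ... | yes _  = contradiction c∈ c∉C↑
  ... | no  ¬↑ = ¬↑

  fallback-decreasing : ∀ {c ds} → c ∈ fallback ds → c ∉ C↓ → ¬ StartsWith _>_ ds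
  fallback-decreasing {ds = ds} c∈ c∉C↓ ↓ with startsWith? _<?_ ds
  ... | yes ↑ = up-down-⊥ {ds} ↑ ↓
  ... | no  _ = c∉C↓ c∈

  colourOf-increasing : ∀ {c ds} → c ∈ colourOf ds → c ∉ C↑ → StartForcesChain _<_ ds
  colourOf-increasing {ds = ds} with monotone? ds | ∣ fromList {N} ds ∣ ≟ k
  ... | yes (inj₁ ↑) | _ = λ _ _ _ → ↑
  ... | yes (inj₂ ↓) | _ = λ _ _ ↑ → ⊥-elim (up-down-⊥ {ds} ↑ (StartsWith-Linked {xs = ds} ↑ ↓))
  ... | no  _        | _ = λ c∈ c∉C↑ ↑ → contradiction ↑ (fallback-increasing c∈ c∉C↑)

  colourOf-decreasing : ∀ {c ds} → c ∈ colourOf ds → c ∉ C↓ → StartForcesChain _>_ ds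
  colourOf-decreasing {ds = ds} with monotone? ds | ∣ fromList {N} ds ∣ ≟ k
  ... | yes (inj₂ ↓) | _ = λ _ _ _ → ↓
  ... | yes (inj₁ ↑) | _ = λ _ _ ↓ → ⊥-elim (up-down-⊥ {ds} (StartsWith-Linked {xs = ds} ↓ ↑) ↓)
  ... | no  _        | _ = λ c∈ c∉C↓ ↓ → contradiction ↓ (fallback-decreasing c∈ c∉C↓)

  module _ (3≤k : 3 ≤ k) {c : Fin r} {W : List ℕ} (W↗ : AllPairs _<_ W) (W<2^N : All (_< 2 ^ N) W)
           (W-mono : ∀ {us} → us ⊑ W → length us ≡ suc k → c ∈ colourOf (consecutive δ us)) where

    open Lifting δ (λ a<b b<c → highestDifferingBit-⊔ N (<⇒≤ a<b) (<⇒≤ b<c)) using (lift)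

    monotone-colour : ∀ {v vs} → v ∷ vs ⊑ W → Monotone (consecutive δ (v ∷ vs)) →
                      (e : Subset N) (h : ∣ e ∣ ≡ k) → e ⊆ fromList (consecutive δ (v ∷ vs)) →
                      c ∈ colour χ e h
    monotone-colour {v} {vs} τ ↕ e h e⊆ =
      subst (c ∈_) (trans (colourOf-monotone σ↕ hσ) (colour-resp-≡ χ hσ h σ≡e)) c∈σ
      where
      σ : List ℕ
      σ = filter (_∈ₗ? elements e) (consecutive δ (v ∷ vs))
      σ⊑ : σ ⊑ consecutive δ (v ∷ vs)
      σ⊑ = filter-⊆ (_∈ₗ? elements e) (consecutive δ (v ∷ vs))
      σ↕ : Monotone σ
      σ↕ = Monotone-resp-⊑ σ⊑ ↕
      σ≡e : fromList σ ≡ e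
      σ≡e = fromList-filter-elements {l = consecutive δ (v ∷ vs)} e⊆
      hσ : ∣ fromList σ ∣ ≡ k
      hσ = trans (cong ∣_∣ σ≡e) h
      vs↗ : AllPairs _<_ (v ∷ vs)
      vs↗ = AllPairs-resp-⊑ τ W↗
      length-σ : length σ ≡ k
      length-σ = trans (sym (∣fromList∣ (Monotone⇒Unique σ↕)
                   (All-resp-⊆ σ⊑ (consecutive-highestDifferingBit-< N vs↗ (All-resp-⊆ τ W<2^N))))) hσ
      c∈σ : c ∈ colourOf σ
      c∈σ with lift vs↗ ↕ σ⊑
      ... | us , us⊑ , us↦σ , len =
        subst (λ ds → c ∈ colourOf ds) us↦σ (W-mono (⊆-trans us⊑ τ) (trans len (cong suc length-σ)))

    clique-of-monotone : ∀ {n vs} → vs ⊑ W → length vs ≡ suc n → Monotone (consecutive δ vs) →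
                         MonoClique χ n
    clique-of-monotone {n} {v ∷ vs} τ len ↕ =
      fromList (consecutive δ (v ∷ vs)) , ∣T∣≡n , c , monotone-colour τ ↕
      where
      ∣T∣≡n : ∣ fromList {N} (consecutive δ (v ∷ vs)) ∣ ≡ n
      ∣T∣≡n = trans (∣fromList∣ (Monotone⇒Unique ↕)
                      (consecutive-highestDifferingBit-< N (AllPairs-resp-⊑ τ W↗) (All-resp-⊆ τ W<2^N)))
                    (trans (length-consecutive δ v vs) (suc-injective len))

    infix-fits : ∀ i m → 0 < m → i + m ≤ length (consecutive δ W) → i + suc m ≤ length W
    infix-fits i m 0<m i+m≤ =
      subst (_≤ length W) (sym (+-suc i m)) (length-consecutive-< δ W (<-≤-trans 0<m (m≤n+m m i)) i+m≤)

    window-colour : ∀ i → i + k ≤ length (consecutive δ W) →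
                    c ∈ colourOf (take k (drop i (consecutive δ W)))
    window-colour i i+k≤ = subst (λ ds → c ∈ colourOf ds) (consecutive-infix δ i k W)
      (W-mono (take-drop-⊑ i (suc k) W)
              (length-take-drop i (suc k) W (infix-fits i k (≤-trans (s≤s z≤n) 3≤k) i+k≤)))

    monotone-sublist : ∀ {n} {R S : Rel ℕ 0ℓ} → k ≤ n → n + n ≤ suc (length W) →
                       (∀ {a b} → a ≢ b → R a b ⊎ S a b) →
                       (∀ {xs} → Linked R xs ⊎ Linked S xs → Monotone xs) →
                       (∀ {ds} → c ∈ colourOf ds → StartForcesChain S ds) →
                       ∃[ vs ] vs ⊑ W × length vs ≡ suc n × Monotone (consecutive δ vs)
    monotone-sublist {n} k≤n 2n≤ split toMonotone forced
      with chain-infix 3≤k k≤n (≤-trans 2n≤ (s≤s (length-consecutive-≥ δ W)))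
             (Linked.map split (consecutive-highestDifferingBit-≢ N W↗ W<2^N))
             (λ i i+k≤ → forced (window-colour i i+k≤))
    ... | i , i+n≤ , run =
      take (suc n) (drop i W) , take-drop-⊑ i (suc n) W ,
      length-take-drop i (suc n) W (infix-fits i n (<-≤-trans (≤-trans (s≤s z≤n) 3≤k) k≤n) i+n≤) ,
      subst Monotone (sym (consecutive-infix δ i n W)) (toMonotone run)

  sublist-colour : ∀ {M} {V : Subset M} {c} →
                   ((e : Subset M) (h : ∣ e ∣ ≡ suc k) → e ⊆ V → c ∈ colour stepUp e h) →
                   ∀ {us} → us ⊑ elements V → length us ≡ suc k → c ∈ colourOf (consecutive δ us)
  sublist-colour {M} {V} {c} V-mono {us} τ len =
    subst (λ vs → c ∈ colourOf (consecutive δ vs)) (elements-fromList us↗ us<M)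
      (V-mono (fromList us) ∣us∣ us⊆V)
    where
    us↗ : AllPairs _<_ us
    us↗ = AllPairs-resp-⊑ τ (elements-sorted V)
    us<M : All (_< M) us
    us<M = All-resp-⊆ τ (elements-< V)
    ∣us∣ : ∣ fromList us ∣ ≡ suc k
    ∣us∣ = trans (∣fromList∣ (AllPairs.map <⇒≢ us↗) us<M) len
    us⊆V : fromList us ⊆ V
    us⊆V x∈ = ∈-elements⁻ (lookup τ (∈-fromList⁻ x∈))

  steppingUp : ∀ {M m n} → 3 ≤ k → k ≤ n → M ≤ 2 ^ N → (∀ c → c ∉ C↑ ⊎ c ∉ C↓) → n + n ≤ suc m →
               MonoClique (stepUp {M}) m → MonoClique χ n
  steppingUp {M} {m} {n} 3≤k k≤n M≤2^N C↑∩C↓≡∅ 2n≤ (V , ∣V∣≡m , c , V-mono) =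
    let vs , τ , len , ↕ = monotone-run (C↑∩C↓≡∅ c)
    in  clique-of-monotone 3≤k W↗ W<2^N (sublist-colour V-mono) τ len ↕
    where
    W↗ : AllPairs _<_ (elements V)
    W↗ = elements-sorted V
    W<2^N : All (_< 2 ^ N) (elements V)
    W<2^N = All.map (λ v<M → <-≤-trans v<M M≤2^N) (elements-< V)
    2n≤′ : n + n ≤ suc (length (elements V))
    2n≤′ = subst (λ l → n + n ≤ suc l) (sym (trans (length-elements V) ∣V∣≡m)) 2n≤
    monotone-run : c ∉ C↑ ⊎ c ∉ C↓ →
                   ∃[ vs ] vs ⊑ elements V × length vs ≡ suc n × Monotone (consecutive δ vs)
    monotone-run (inj₁ c∉C↑) = monotone-sublist 3≤k W↗ W<2^N (sublist-colour V-mono) k≤n 2n≤′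
                                 (Sum.swap ∘ ≢⇒<⊎>) Sum.swap (λ c∈ → colourOf-increasing c∈ c∉C↑)
    monotone-run (inj₂ c∉C↓) = monotone-sublist 3≤k W↗ W<2^N (sublist-colour V-mono) k≤n 2n≤′
                                 ≢⇒<⊎> id (λ c∈ → colourOf-decreasing c∈ c∉C↓)

-- Two disjoint blocks of s colours

block : ℕ → ℕ → Subset m
block lo len = fromList (applyUpTo (lo +_) len)

∣block∣ : ∀ lo len → lo + len ≤ m → ∣ block {m} lo len ∣ ≡ len
∣block∣ lo len lo+len≤m = trans
  (∣fromList∣ (AllPairs.map <⇒≢ (AllPairs.applyUpTo⁺₁ (lo +_) len (λ i<j _ → +-monoʳ-< lo i<j)))
              (All.applyUpTo⁺₁ (lo +_) len (λ i<len → <-≤-trans (+-monoʳ-< lo i<len) lo+len≤m)))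
  (length-applyUpTo (lo +_) len)

∈-block⁻ : ∀ {lo len} → x ∈ block lo len → lo ≤ toℕ x × toℕ x < lo + len
∈-block⁻ {lo = lo} x∈ with ∈-applyUpTo⁻ (lo +_) (∈-fromList⁻ x∈)
... | i , i<len , x≡lo+i =
  subst (lo ≤_) (sym x≡lo+i) (m≤m+n lo i) , subst (_< lo + _) (sym x≡lo+i) (+-monoʳ-< lo i<len)

∉block⊎∉block : ∀ (x : Fin m) lo a b → x ∉ block lo a ⊎ x ∉ block (lo + a) b
∉block⊎∉block x lo a b with toℕ x <? lo + a
... | yes x< = inj₂ (λ x∈ → <⇒≱ x< (proj₁ (∈-block⁻ {lo = lo + a} {b} x∈)))
... | no  x≮ = inj₁ (λ x∈ → x≮ (proj₂ (∈-block⁻ {lo = lo} {a} x∈)))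

n+n≤1+[2n∸1] : ∀ n → n + n ≤ suc (2 * n ∸ 1)
n+n≤1+[2n∸1] n = subst (_≤ suc (2 * n ∸ 1)) (cong (n +_) (+-identityʳ n)) (m≤n+m∸n (2 * n) 1)

theorem5p3 : (k : ℕ) → 3 ≤ k → (N n r s : ℕ) → 0 < N → k < n → 1 ≤ s → 2 * s ≤ r →
    RamseyExceeds k n r s N → RamseyExceeds (suc k) (2 * n ∸ 1) r s (2 ^ N)
theorem5p3 k 3≤k N n r s _ k<n _ 2s≤r R>N M M≤2^N stepped-arrows = R>N N ≤-refl λ χ →
  let open SteppingUp χ (block 0 s) (block s s) (∣block∣ 0 s (m+n≤o⇒m≤o s s+s≤r)) (∣block∣ s s s+s≤r)
  in  steppingUp 3≤k (<⇒≤ k<n) M≤2^N (λ c → ∉block⊎∉block c 0 s s) (n+n≤1+[2n∸1] n)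
                 (stepped-arrows stepUp)
  where
  s+s≤r : s + s ≤ r
  s+s≤r = subst (_≤ r) (cong (s +_) (+-identityʳ s)) 2s≤r
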